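{- Let $n$ be a positive integer and consider the random $1$-Naples parking model with $p=1/2$. Then $\alpha\in\{1,\ldots,n\}^n$ is not a $1$-Naples parking function if and only if $\mathbb{P}(\alpha\text{ parks})=0$.
   Context: Parking spots $1,\ldots,n$ in a line; cars $C_1,\ldots,C_n$ arrive in order, $C_i$ preferring spot $\alpha_i$; a car whose preferred spot is empty parks there. $\alpha$ is a $1$-Naples parking function if all cars park when each car whose preferred spot $\alpha_i$ is occupied parks at $\alpha_i-1$ if $\alpha_i\ge 2$ and that spot is empty, and otherwise in the first empty spot among $\alpha_i+1,\ldots,n$ (failing if none). In the random $1$-Naples model with $p=1/2$, each car whose preferred spot is occupied independently follows this backing-up rule with probability $1/2$, and with probability $1/2$ parks in the first empty spot among $\alpha_i+1,\ldots,n$ (failing if none). $\alpha$ parks if every car parks. -}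

module Defs where

open import Data.Bool using (Bool; true; false; not; if_then_else_; _∧_)
open import Data.Nat using (ℕ; zero; suc; _+_; _∸_; _≡ᵇ_; _≤ᵇ_)
open import Data.Fin using (Fin; toℕ)
open import Data.List using (List; []; _∷_; applyUpTo; findᵇ)
open import Data.Bool.ListAction using (any)
open import Data.Maybe using (Maybe; just; nothing)
open import Data.Vec using (Vec; []; _∷_)
open import Relation.Binary.PropositionalEquality using (_≡_)
open import Data.Rational using (ℚ; 0ℚ; 1ℚ; ½) renaming (_+_ to _+ℚ_; _*_ to _*ℚ_)

-- Spots are the naturals 1..n. A configuration of parked cars is the list
-- of occupied spots. A preference of car i is α_i ∈ {1..n}, encoded as
-- a : Fin n with spot suc (toℕ a).

occupied : List ℕ → ℕ → Bool
occupied occ s = any (λ t → t ≡ᵇ s) occ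

forwardSpot : ℕ → List ℕ → ℕ → Maybe ℕ
forwardSpot n occ a = findᵇ (λ s → not (occupied occ s)) (applyUpTo (λ k → suc (a + k)) (n ∸ a))

backSpot : ℕ → List ℕ → ℕ → Maybe ℕ
backSpot n occ (suc (suc b)) = if occupied occ (suc b) then forwardSpot n occ (suc (suc b)) else just (suc b)
backSpot n occ a = forwardSpot n occ a

naplesParks : (n : ℕ) → List ℕ → {m : ℕ} → Vec (Fin n) m → Bool
naplesParks n occ [] = true
naplesParks n occ (a ∷ as) with occupied occ (suc (toℕ a))
... | false = naplesParks n (suc (toℕ a) ∷ occ) as
... | true with backSpot n occ (suc (toℕ a))
...   | nothing = false
...   | just s  = naplesParks n (s ∷ occ) as

IsNaplesPF : (n : ℕ) → Vec (Fin n) n → Set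
IsNaplesPF n α = naplesParks n [] α ≡ true


outcome : ℕ → Maybe ℕ → (List ℕ → ℚ) → List ℕ → ℚ
outcome n nothing  k occ = 0ℚ
outcome n (just s) k occ = k (s ∷ occ)

probParks : (n : ℕ) → List ℕ → {m : ℕ} → Vec (Fin n) m → ℚ
probParks n occ [] = 1ℚ
probParks n occ (a ∷ as) with occupied occ (suc (toℕ a))
... | false = probParks n (suc (toℕ a) ∷ occ) as
... | true  =
  (½ *ℚ outcome n (backSpot n occ (suc (toℕ a))) (λ o → probParks n o as) occ)
  +ℚ (½ *ℚ outcome n (forwardSpot n occ (suc (toℕ a))) (λ o → probParks n o as) occ)

ℙparks : (n : ℕ) → Vec (Fin n) n → ℚ
ℙparks n α = probParks n [] α

-- Run the deterministic 1-Naples process next to any single branch of the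
-- random one.  Invariant: on every final segment of spots [t, n] the random
-- branch has parked at least as many cars as the Naples process.  A car
-- preserves it because the Naples rule sends it no further right than any
-- legal move of the random rule, except past a block that is already full in
-- the Naples configuration.  When a Naples car fails, all spots from the lowest
-- one it could reach up to n are full, hence full in the random branch as
-- well, so that branch fails too: every branch fails and the probability is 0.
-- Conversely, if the Naples process succeeds, the branch that always backs up
-- has positive probability.
module Submission where

open import Defs
open import Data.Bool using (Bool; true; false; not; _∨_)
open import Data.Bool.Properties using (not-injective; T-≡)
open import Data.Nat using (ℕ; zero; suc; _+_; _∸_; _≡ᵇ_; _≤_; _<_; z≤n; s≤s; z<s; _<?_)
open import Data.Nat.Properties
open import Data.Fin using (Fin; toℕ)
open import Data.Fin.Properties using (toℕ<n)
open import Data.Vec using (Vec; []; _∷_)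
open import Data.List using (List; []; _∷_; applyUpTo; findᵇ)
open import Data.Maybe using (Maybe; just; nothing)
open import Data.Product using (_×_; _,_)
open import Data.Sum using (_⊎_; inj₁; inj₂; [_,_]′)
open import Data.Rational using (ℚ; 0ℚ; 1ℚ; ½) renaming (_+_ to _+ℚ_; _*_ to _*ℚ_; _≤_ to _≤ℚ_; _<_ to _<ℚ_)
import Data.Rational.Properties as ℚ
open import Function.Bundles using (_⇔_; mk⇔; Equivalence)
open import Relation.Binary.PropositionalEquality
open import Relation.Nullary using (¬_; yes; no; contradiction)

≡ᵇ-refl : ∀ m → (m ≡ᵇ m) ≡ true
≡ᵇ-refl m = Equivalence.to T-≡ (≡⇒≡ᵇ m m refl)

≢⇒≡ᵇ-false : ∀ m n → m ≢ n → (m ≡ᵇ n) ≡ false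
≢⇒≡ᵇ-false m n m≢n with m ≡ᵇ n in e
... | false = refl
... | true  = contradiction (≡ᵇ⇒≡ m n (Equivalence.from T-≡ e)) m≢n

boolToℕ : Bool → ℕ
boolToℕ true  = 1
boolToℕ false = 0

boolToℕ≤1 : ∀ b → boolToℕ b ≤ 1
boolToℕ≤1 true  = ≤-refl
boolToℕ≤1 false = z≤n

boolToℕ-mono-∨ : ∀ a b → boolToℕ b ≤ boolToℕ (a ∨ b)
boolToℕ-mono-∨ true  false = z≤n
boolToℕ-mono-∨ true  true  = ≤-refl
boolToℕ-mono-∨ false b     = ≤-refl

count : List ℕ → ℕ → ℕ → ℕ
count X t zero    = 0
count X t (suc k) = boolToℕ (occupied X t) + count X (suc t) k

count≤ : ∀ X t k → count X t k ≤ k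
count≤ X t zero    = z≤n
count≤ X t (suc k) = +-mono-≤ (boolToℕ≤1 (occupied X t)) (count≤ X (suc t) k)

count-+ : ∀ X t i j → count X t (i + j) ≡ count X t i + count X (t + i) j
count-+ X t zero    j rewrite +-identityʳ t = refl
count-+ X t (suc i) j rewrite count-+ X (suc t) i j | +-suc t i =
  sym (+-assoc (boolToℕ (occupied X t)) (count X (suc t) i) (count X (suc t + i) j))

full⇒count≡ : ∀ X t k → (∀ u → t ≤ u → u < t + k → occupied X u ≡ true) → count X t k ≡ k
full⇒count≡ X t zero    full = refl
full⇒count≡ X t (suc k) full rewrite full t ≤-refl (m<m+n t z<s) =
  cong suc (full⇒count≡ X (suc t) k λ u t<u u<t+k → full u (<⇒≤ t<u) (subst (u <_) (sym (+-suc t k)) u<t+k))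

vacant⇒count< : ∀ X t k u → t ≤ u → u < t + k → occupied X u ≡ false → count X t k < k
vacant⇒count< X t zero    u t≤u u<t _ = contradiction (subst (_≤ u) (sym (+-identityʳ t)) t≤u) (<⇒≱ u<t)
vacant⇒count< X t (suc k) u t≤u u<t+k vacant with m≤n⇒m<n∨m≡n t≤u
... | inj₂ refl rewrite vacant = s≤s (count≤ X (suc t) k)
... | inj₁ t<u = ≤-trans (s≤s (+-monoˡ-≤ (count X (suc t) k) (boolToℕ≤1 (occupied X t))))
                   (s≤s (vacant⇒count< X (suc t) k u t<u (subst (u <_) (+-suc t k) u<t+k) vacant))

count≡⇒full : ∀ X t k → count X t k ≡ k → ∀ u → t ≤ u → u < t + k → occupied X u ≡ true
count≡⇒full X t k c≡k u t≤u u<t+k with occupied X u in e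
... | true  = refl
... | false = contradiction c≡k (<⇒≢ (vacant⇒count< X t k u t≤u u<t+k e))

count-∷-outside : ∀ s X t k → s < t ⊎ t + k ≤ s → count (s ∷ X) t k ≡ count X t k
count-∷-outside s X t zero    _       = refl
count-∷-outside s X t (suc k) outside
  rewrite ≢⇒≡ᵇ-false s t (λ { refl → [ <-irrefl refl , <⇒≱ (m<m+n s z<s) ]′ outside }) =
  cong (boolToℕ (occupied X t) +_) (count-∷-outside s X (suc t) k (shift outside))
  where
  shift : s < t ⊎ t + suc k ≤ s → s < suc t ⊎ suc t + k ≤ s
  shift (inj₁ s<t)   = inj₁ (m<n⇒m<1+n s<t)
  shift (inj₂ t+k≤s) = inj₂ (subst (_≤ s) (+-suc t k) t+k≤s)

count-∷-inside : ∀ s X t k → t ≤ s → s < t + k → occupied X s ≡ false → count (s ∷ X) t k ≡ suc (count X t k)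
count-∷-inside s X t zero    t≤s s<t _ = contradiction (subst (_≤ s) (sym (+-identityʳ t)) t≤s) (<⇒≱ s<t)
count-∷-inside s X t (suc k) t≤s s<t+k vacant with m≤n⇒m<n∨m≡n t≤s
... | inj₂ refl rewrite ≡ᵇ-refl s | vacant = cong suc (count-∷-outside s X (suc s) k (inj₁ ≤-refl))
... | inj₁ t<s rewrite ≢⇒≡ᵇ-false s t (λ { refl → <-irrefl refl t<s }) = begin
  boolToℕ (occupied X t) + count (s ∷ X) (suc t) k
    ≡⟨ cong (boolToℕ (occupied X t) +_) (count-∷-inside s X (suc t) k t<s (subst (s <_) (+-suc t k) s<t+k) vacant) ⟩
  boolToℕ (occupied X t) + suc (count X (suc t) k)
    ≡⟨ +-suc (boolToℕ (occupied X t)) (count X (suc t) k) ⟩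
  suc (count X t (suc k)) ∎
  where open ≡-Reasoning

count-∷-mono : ∀ s X t k → count X t k ≤ count (s ∷ X) t k
count-∷-mono s X t zero    = z≤n
count-∷-mono s X t (suc k) = +-mono-≤ (boolToℕ-mono-∨ (s ≡ᵇ t) (occupied X t)) (count-∷-mono s X (suc t) k)

extend-occupied : ∀ X v x → occupied X v ≡ true → (∀ u → v < u → u < x → occupied X u ≡ true) →
                  ∀ u → v ≤ u → u < x → occupied X u ≡ true
extend-occupied X v x occ-v occ-above u v≤u u<x with m≤n⇒m<n∨m≡n v≤u
... | inj₁ v<u  = occ-above u v<u u<x
... | inj₂ refl = occ-v

findᵇ-applyUpTo-just : ∀ (p : ℕ → Bool) m (g : ℕ → ℕ) c → (∀ k → g k ≡ c + k) → ∀ s →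
  findᵇ p (applyUpTo g m) ≡ just s →
  c ≤ s × s < c + m × p s ≡ true × (∀ u → c ≤ u → u < s → p u ≡ false)
findᵇ-applyUpTo-just p zero    g c g≗c+ s ()
findᵇ-applyUpTo-just p (suc m) g c g≗c+ s found with p (g 0) in p-head
findᵇ-applyUpTo-just p (suc m) g c g≗c+ s refl | true rewrite g≗c+ 0 | +-identityʳ c =
  ≤-refl , m<m+n c z<s , p-head , λ u c≤u u<c → contradiction c≤u (<⇒≱ u<c)
... | false with findᵇ-applyUpTo-just p m (λ k → g (suc k)) (suc c) (λ k → trans (g≗c+ (suc k)) (+-suc c k)) s found
... | c<s , s<c+m , p-s , p-below = <⇒≤ c<s , subst (s <_) (sym (+-suc c m)) s<c+m , p-s , p-below′
  where
  p-below′ : ∀ u → c ≤ u → u < s → p u ≡ false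
  p-below′ u c≤u u<s with m≤n⇒m<n∨m≡n c≤u
  ... | inj₁ c<u  = p-below u c<u u<s
  ... | inj₂ refl = trans (cong p (trans (sym (+-identityʳ c)) (sym (g≗c+ 0)))) p-head

findᵇ-applyUpTo-nothing : ∀ (p : ℕ → Bool) m (g : ℕ → ℕ) c → (∀ k → g k ≡ c + k) →
  findᵇ p (applyUpTo g m) ≡ nothing → ∀ u → c ≤ u → u < c + m → p u ≡ false
findᵇ-applyUpTo-nothing p zero g c g≗c+ _ u c≤u u<c =
  contradiction (subst (_≤ u) (sym (+-identityʳ c)) c≤u) (<⇒≱ u<c)
findᵇ-applyUpTo-nothing p (suc m) g c g≗c+ none u c≤u u<c+m with p (g 0) in p-head
findᵇ-applyUpTo-nothing p (suc m) g c g≗c+ () u c≤u u<c+m | true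
... | false with m≤n⇒m<n∨m≡n c≤u
... | inj₂ refl = trans (cong p (trans (sym (+-identityʳ c)) (sym (g≗c+ 0)))) p-head
... | inj₁ c<u  = findᵇ-applyUpTo-nothing p m (λ k → g (suc k)) (suc c) (λ k → trans (g≗c+ (suc k)) (+-suc c k))
                    none u c<u (subst (u <_) (+-suc c m) u<c+m)

module _ (n : ℕ) where

  forwardSpot-just : ∀ X a s → a ≤ n → forwardSpot n X a ≡ just s →
    a < s × s ≤ n × occupied X s ≡ false × (∀ u → a < u → u < s → occupied X u ≡ true)
  forwardSpot-just X a s a≤n found
    with findᵇ-applyUpTo-just (λ s → not (occupied X s)) (n ∸ a) (λ k → suc (a + k)) (suc a) (λ _ → refl) s found
  ... | a<s , s≤n , free , full-below =
    a<s , subst (s ≤_) (m+[n∸m]≡n a≤n) (≤-pred s≤n) , not-injective {y = false} free ,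
    λ u a<u u<s → not-injective {y = true} (full-below u a<u u<s)

  forwardSpot-nothing : ∀ X a → a ≤ n → forwardSpot n X a ≡ nothing →
    ∀ u → a < u → u < suc n → occupied X u ≡ true
  forwardSpot-nothing X a a≤n none u a<u u≤n =
    not-injective {y = true} (findᵇ-applyUpTo-nothing (λ s → not (occupied X s)) (n ∸ a) (λ k → suc (a + k)) (suc a)
      (λ _ → refl) none u a<u (subst (u <_) (cong suc (sym (m+[n∸m]≡n a≤n))) u≤n))

  -- A car preferring spot suc a₀ never parks below lowestReachable a₀.
  lowestReachable : ℕ → ℕ
  lowestReachable zero     = 1
  lowestReachable (suc a₀) = suc a₀

  ≤lowestReachable : ∀ a₀ → a₀ ≤ lowestReachable a₀
  ≤lowestReachable zero     = z≤n
  ≤lowestReachable (suc a₀) = ≤-refl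

  lowestReachable≤suc : ∀ a₀ → lowestReachable a₀ ≤ suc a₀
  lowestReachable≤suc zero     = ≤-refl
  lowestReachable≤suc (suc a₀) = n≤1+n _

  -- How the Naples car preferring suc a₀ reached x; for a car driven forward
  -- only the block of occupied spots it passed matters.
  data NaplesMove (S : List ℕ) (a₀ : ℕ) : ℕ → Set where
    preferred : NaplesMove S a₀ (suc a₀)
    backed    : NaplesMove S a₀ (lowestReachable a₀)
    forward   : ∀ {x} → (∀ u → lowestReachable a₀ ≤ u → u < x → occupied S u ≡ true) → NaplesMove S a₀ x

  NaplesLanding : List ℕ → ℕ → ℕ → Set
  NaplesLanding S a₀ x = occupied S x ≡ false × x ≤ n × NaplesMove S a₀ x

  VacantReachable : List ℕ → ℕ → ℕ → Set
  VacantReachable T a₀ y = occupied T y ≡ false × y ≤ n × lowestReachable a₀ ≤ y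

  RandomLanding : List ℕ → ℕ → ℕ → Set
  RandomLanding T a₀ y = VacantReachable T a₀ y × (y ≤ a₀ → occupied T (suc a₀) ≡ true)

  backSpot-naples : ∀ S a₀ x → suc a₀ ≤ n → occupied S (suc a₀) ≡ true →
    backSpot n S (suc a₀) ≡ just x → NaplesLanding S a₀ x
  backSpot-naples S zero x a≤n occ-a found with forwardSpot-just S 1 x a≤n found
  ... | _ , x≤n , free , full-between = free , x≤n , forward (extend-occupied S 1 x occ-a full-between)
  backSpot-naples S (suc c) x a≤n occ-a found with occupied S (suc c) in occ-c
  backSpot-naples S (suc c) x a≤n occ-a refl | false = occ-c , ≤-trans (n≤1+n _) a≤n , backed
  ... | true with forwardSpot-just S (suc (suc c)) x a≤n found
  ... | _ , x≤n , free , full-between =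
    free , x≤n , forward (extend-occupied S (suc c) x occ-c (extend-occupied S (suc (suc c)) x occ-a full-between))

  backSpot-nothing : ∀ S a₀ → suc a₀ ≤ n → occupied S (suc a₀) ≡ true → backSpot n S (suc a₀) ≡ nothing →
    ∀ u → lowestReachable a₀ ≤ u → u < suc n → occupied S u ≡ true
  backSpot-nothing S zero a≤n occ-a none = extend-occupied S 1 (suc n) occ-a (forwardSpot-nothing S 1 a≤n none)
  backSpot-nothing S (suc c) a≤n occ-a none with occupied S (suc c) in occ-c
  backSpot-nothing S (suc c) a≤n occ-a () | false
  ... | true = extend-occupied S (suc c) (suc n) occ-c
                 (extend-occupied S (suc (suc c)) (suc n) occ-a (forwardSpot-nothing S (suc (suc c)) a≤n none))

  forwardSpot-random : ∀ T a₀ y → suc a₀ ≤ n → forwardSpot n T (suc a₀) ≡ just y → VacantReachable T a₀ y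
  forwardSpot-random T a₀ y a≤n found with forwardSpot-just T (suc a₀) y a≤n found
  ... | a<y , y≤n , free , _ = free , y≤n , ≤-trans (≤-trans (lowestReachable≤suc a₀) (n≤1+n _)) a<y

  backSpot-random : ∀ T a₀ y → suc a₀ ≤ n → backSpot n T (suc a₀) ≡ just y → VacantReachable T a₀ y
  backSpot-random T zero y a≤n found = forwardSpot-random T zero y a≤n found
  backSpot-random T (suc c) y a≤n found with occupied T (suc c) in occ-c
  ... | true = forwardSpot-random T (suc c) y a≤n found
  backSpot-random T (suc c) y a≤n refl | false = occ-c , ≤-trans (n≤1+n _) a≤n , ≤-refl

  outcome-zero : ∀ (spot : Maybe ℕ) (κ : List ℕ → ℚ) T → (∀ y → spot ≡ just y → κ (y ∷ T) ≡ 0ℚ) →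
    outcome n spot κ T ≡ 0ℚ
  outcome-zero nothing  κ T _          = refl
  outcome-zero (just y) κ T zero-after = zero-after y refl

  probParks-∷-zero : ∀ {m} T (i : Fin n) (as : Vec (Fin n) m) →
    (∀ y → RandomLanding T (toℕ i) y → probParks n (y ∷ T) as ≡ 0ℚ) → probParks n T (i ∷ as) ≡ 0ℚ
  probParks-∷-zero T i as zero-after with occupied T (suc (toℕ i)) in occ-a
  ... | false = zero-after (suc (toℕ i))
    ((occ-a , toℕ<n i , lowestReachable≤suc (toℕ i)) , λ a≤a₀ → contradiction a≤a₀ (<-irrefl refl))
  ... | true  = cong₂ (λ p q → (½ *ℚ p) +ℚ (½ *ℚ q))
    (outcome-zero (backSpot n T (suc (toℕ i))) _ T λ y found →
      zero-after y (backSpot-random T (toℕ i) y (toℕ<n i) found , λ _ → refl))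
    (outcome-zero (forwardSpot n T (suc (toℕ i))) _ T λ y found →
      zero-after y (forwardSpot-random T (toℕ i) y (toℕ<n i) found , λ _ → refl))

  _≼_ : List ℕ → List ℕ → Set
  S ≼ T = ∀ t k → t + k ≡ suc n → count S t k ≤ count T t k

  ≼-refl : ∀ S → S ≼ S
  ≼-refl S _ _ _ = ≤-refl

  ≼-full : ∀ S T b → S ≼ T → b ≤ suc n → (∀ u → b ≤ u → u < suc n → occupied S u ≡ true) →
    ∀ u → b ≤ u → u < suc n → occupied T u ≡ true
  ≼-full S T b S≼T b≤ full-S u b≤u u<n with suc n ∸ b | m+[n∸m]≡n b≤
  ... | k | b+k≡ = count≡⇒full T b k (≤-antisym (count≤ T b k) k≤count-T) u b≤u (subst (u <_) (sym b+k≡) u<n)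
    where
    full-S′ : ∀ u → b ≤ u → u < b + k → occupied S u ≡ true
    full-S′ u b≤u u<b+k = full-S u b≤u (subst (u <_) b+k≡ u<b+k)
    k≤count-T : k ≤ count T b k
    k≤count-T = subst (_≤ count T b k) (full⇒count≡ S b k full-S′) (S≼T b k b+k≡)

  ≼-strict-at : ∀ S T t k → S ≼ T → t ≤ n → occupied S t ≡ false → occupied T t ≡ true →
    t + k ≡ suc n → count S t k < count T t k
  ≼-strict-at S T t zero    S≼T t≤n _ _ t+0≡ = contradiction (trans (sym (+-identityʳ t)) t+0≡) (<⇒≢ (s≤s t≤n))
  ≼-strict-at S T t (suc k) S≼T t≤n free-S occ-T t+k≡ rewrite free-S | occ-T =
    s≤s (S≼T (suc t) k (trans (sym (+-suc t k)) t+k≡))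

  -- S is full on [b, x) while T has a vacancy y in [b, t): the deficit of S on
  -- [b, t) is 0 and that of T is positive, so T must lead S on [t, n].
  ≼-strict-beyond-vacancy : ∀ S T t k b y x → S ≼ T → t + k ≡ suc n → b ≤ y → y < t → t ≤ x →
    occupied T y ≡ false → (∀ u → b ≤ u → u < x → occupied S u ≡ true) → count S t k < count T t k
  ≼-strict-beyond-vacancy S T t k b y x S≼T t+k≡ b≤y y<t t≤x vacant-y full-S
    with t ∸ b | m+[n∸m]≡n (≤-trans b≤y (<⇒≤ y<t))
  ... | d | refl = +-cancelˡ-≤ (count T b d) _ _ (begin
    count T b d + suc (count S (b + d) k) ≡⟨ +-suc (count T b d) _ ⟩
    suc (count T b d) + count S (b + d) k ≤⟨ +-monoˡ-≤ _ (vacant⇒count< T b d y b≤y y<t vacant-y) ⟩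
    d + count S (b + d) k                 ≡⟨ cong (_+ count S (b + d) k) (sym full-S-prefix) ⟩
    count S b d + count S (b + d) k       ≡⟨ sym (count-+ S b d k) ⟩
    count S b (d + k)                     ≤⟨ S≼T b (d + k) (trans (sym (+-assoc b d k)) t+k≡) ⟩
    count T b (d + k)                     ≡⟨ count-+ T b d k ⟩
    count T b d + count T (b + d) k       ∎)
    where
    open ≤-Reasoning
    full-S-prefix : count S b d ≡ d
    full-S-prefix = full⇒count≡ S b d λ u b≤u u<b+d → full-S u b≤u (≤-trans u<b+d t≤x)

  ≼-step : ∀ S T a₀ x y → S ≼ T → NaplesLanding S a₀ x → RandomLanding T a₀ y → (x ∷ S) ≼ (y ∷ T)
  ≼-step S T a₀ x y S≼T (free-x , x≤n , move) ((free-y , y≤n , low≤y) , below⇒occ-a) t k t+k≡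
    with x <? t
  ... | yes x<t rewrite count-∷-outside x S t k (inj₁ x<t) = ≤-trans (S≼T t k t+k≡) (count-∷-mono y T t k)
  ... | no x≮t rewrite count-∷-inside x S t k (≮⇒≥ x≮t) (subst (x <_) (sym t+k≡) (s≤s x≤n)) free-x
    with y <? t
  ...   | no y≮t rewrite count-∷-inside y T t k (≮⇒≥ y≮t) (subst (y <_) (sym t+k≡) (s≤s y≤n)) free-y =
    s≤s (S≼T t k t+k≡)
  ...   | yes y<t rewrite count-∷-outside y T t k (inj₁ y<t) = strict move
    where
    t≤x : t ≤ x
    t≤x = ≮⇒≥ x≮t
    strict : NaplesMove S a₀ x → count S t k < count T t k
    strict preferred = subst (λ t → t + k ≡ suc n → count S t k < count T t k) (sym t≡a)
      (≼-strict-at S T (suc a₀) k S≼T x≤n free-x (below⇒occ-a (≤-pred (≤-trans y<t t≤x)))) t+k≡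
      where
      t≡a : t ≡ suc a₀
      t≡a = ≤-antisym t≤x (≤-trans (s≤s (≤-trans (≤lowestReachable a₀) low≤y)) y<t)
    strict backed = contradiction (≤-trans t≤x low≤y) (<⇒≱ y<t)
    strict (forward full-S) =
      ≼-strict-beyond-vacancy S T t k (lowestReachable a₀) y x S≼T t+k≡ low≤y y<t t≤x free-y full-S

  naples-fails⇒probParks≡0 : ∀ {m} (as : Vec (Fin n) m) S T → S ≼ T → naplesParks n S as ≡ false →
    probParks n T as ≡ 0ℚ
  naples-fails⇒probParks≡0 [] S T S≼T ()
  naples-fails⇒probParks≡0 (i ∷ as) S T S≼T fails with occupied S (suc (toℕ i)) in occ-a
  ... | false = probParks-∷-zero T i as λ y land-y → naples-fails⇒probParks≡0 as _ _
                  (≼-step S T (toℕ i) (suc (toℕ i)) y S≼T (occ-a , toℕ<n i , preferred) land-y) fails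
  ... | true with backSpot n S (suc (toℕ i)) in found
  ...   | just x = probParks-∷-zero T i as λ y land-y → naples-fails⇒probParks≡0 as _ _
                  (≼-step S T (toℕ i) x y S≼T (backSpot-naples S (toℕ i) x (toℕ<n i) occ-a found) land-y) fails
  ...   | nothing = probParks-∷-zero T i as λ { y ((free-y , y≤n , low≤y) , _) →
    contradiction (trans (sym free-y) (≼-full S T (lowestReachable (toℕ i)) S≼T
                    (≤-trans (lowestReachable≤suc (toℕ i)) (<⇒≤ (s≤s (toℕ<n i))))
                    (backSpot-nothing S (toℕ i) (toℕ<n i) occ-a found) y low≤y (s≤s y≤n)))
                  λ () }

½*-nonneg : ∀ p → 0ℚ ≤ℚ p → 0ℚ ≤ℚ ½ *ℚ p
½*-nonneg p 0≤p = subst (_≤ℚ ½ *ℚ p) (ℚ.*-zeroʳ ½) (ℚ.*-monoˡ-≤-nonNeg ½ 0≤p)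

½*-pos : ∀ p → 0ℚ <ℚ p → 0ℚ <ℚ ½ *ℚ p
½*-pos p 0<p = subst (_<ℚ ½ *ℚ p) (ℚ.*-zeroʳ ½) (ℚ.*-monoʳ-<-pos ½ 0<p)

module _ (n : ℕ) where

  outcome-nonneg : ∀ spot (κ : List ℕ → ℚ) T → (∀ X → 0ℚ ≤ℚ κ X) → 0ℚ ≤ℚ outcome n spot κ T
  outcome-nonneg nothing  κ T _        = ℚ.≤-refl
  outcome-nonneg (just y) κ T κ-nonneg = κ-nonneg (y ∷ T)

  probParks-nonneg : ∀ {m} (as : Vec (Fin n) m) T → 0ℚ ≤ℚ probParks n T as
  probParks-nonneg []       T = ℚ.<⇒≤ (ℚ.positive⁻¹ 1ℚ)
  probParks-nonneg (i ∷ as) T with occupied T (suc (toℕ i))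
  ... | false = probParks-nonneg as _
  ... | true  = ℚ.+-mono-≤
    (½*-nonneg _ (outcome-nonneg (backSpot n T (suc (toℕ i))) _ T (probParks-nonneg as)))
    (½*-nonneg _ (outcome-nonneg (forwardSpot n T (suc (toℕ i))) _ T (probParks-nonneg as)))

  -- The backing-up branch of probParks follows the Naples process exactly.
  naples-parks⇒probParks>0 : ∀ {m} (as : Vec (Fin n) m) S → naplesParks n S as ≡ true → 0ℚ <ℚ probParks n S as
  naples-parks⇒probParks>0 []       S _ = ℚ.positive⁻¹ 1ℚ
  naples-parks⇒probParks>0 (i ∷ as) S parks with occupied S (suc (toℕ i))
  ... | false = naples-parks⇒probParks>0 as _ parks
  ... | true with backSpot n S (suc (toℕ i))
  ...   | just x = ℚ.+-mono-<-≤ (½*-pos _ (naples-parks⇒probParks>0 as (x ∷ S) parks))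
                     (½*-nonneg _ (outcome-nonneg (forwardSpot n S (suc (toℕ i))) _ S (probParks-nonneg as)))

theorem8 : (n : ℕ) → 1 ≤ n → (α : Vec (Fin n) n) →
    (¬ IsNaplesPF n α) ⇔ (ℙparks n α ≡ 0ℚ)
theorem8 n _ α = mk⇔ not-PF⇒ℙ≡0 ℙ≡0⇒not-PF
  where
  not-PF⇒ℙ≡0 : ¬ IsNaplesPF n α → ℙparks n α ≡ 0ℚ
  not-PF⇒ℙ≡0 not-PF with naplesParks n [] α in fails
  ... | true  = contradiction refl not-PF
  ... | false = naples-fails⇒probParks≡0 n α [] [] (≼-refl n []) fails

  ℙ≡0⇒not-PF : ℙparks n α ≡ 0ℚ → ¬ IsNaplesPF n α
  ℙ≡0⇒not-PF ℙ≡0 PF = ℚ.<-irrefl (sym ℙ≡0) (naples-parks⇒probParks>0 n α [] PF)
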